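{- If $G=(V,E)$ is a finite connected bipartite graph and $P$ is a geodesic path in $G$, then $P$ is $(1,1)$-guardable.
   Context: Graphs are finite, connected and reflexive. A geodesic path is a shortest path between its endpoints. The Cops and Attacking Robbers game on $G$: cops are first placed on vertices, then the robber chooses a vertex; in each round the cops move (each to an adjacent vertex or staying) and then the robber moves (to an adjacent vertex or staying). A cop captures the robber by moving onto the robber's vertex. If the robber moves onto a vertex occupied by one or more cops, exactly one of them is removed from the game. A subgraph $H\subseteq G$ is $(k,t)$-guardable if, in the Cops and Attacking Robbers game on $G$, $k+t$ cops can in finitely many steps move so that $k$ cops are placed on vertices of $H$ in such a way that, from then on, if the robber ever moves into $H$, the cops immediately capture the robber (after this positioning, the other $t$ cops are no longer needed for guarding $H$). -}

module Defs where

open import Data.Nat using (ℕ; zero; suc; _≤_; _+_)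
open import Data.Fin using (Fin; _≟_)
open import Data.Bool using (Bool)
open import Data.List using (List; []; _∷_; length; _++_)
open import Data.List.Membership.Propositional using (_∈_; _∉_)
open import Data.Empty using (⊥)
open import Data.List.Relation.Binary.Pointwise using (Pointwise)
open import Data.List.Relation.Binary.Permutation.Propositional using (_↭_)
open import Data.List.Relation.Unary.All using (All)
open import Data.List.Relation.Unary.Unique.Propositional using (Unique)
open import Data.Product using (Σ; ∃; _×_; _,_; proj₁)
open import Data.Sum using (_⊎_)
open import Relation.Nullary using (yes; no; ¬_)
open import Relation.Binary.PropositionalEquality using (_≡_; _≢_)
open import Relation.Binary using (Decidable)

-- Finite reflexive graphs on the vertex set Fin n.
-- u ~ v means "u and v are adjacent"; every vertex has a loop
-- (reflexive), so "move to an adjacent vertex or stay" is a ~-step.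

record Graph : Set₁ where
  field
    n      : ℕ
    _~_    : Fin n → Fin n → Set
    ~-refl : ∀ v → v ~ v
    ~-sym  : ∀ {u v} → u ~ v → v ~ u
    _~?_   : Decidable _~_

module _ (G : Graph) where
  open Graph G
  open import Data.List.Membership.DecPropositional (_≟_ {n}) using (_∈?_)

  V : Set
  V = Fin n

  data Walk : V → V → ℕ → Set where
    here : ∀ {v} → Walk v v 0
    step : ∀ {u v w m} → u ~ v → Walk v w m → Walk u w (suc m)

  walkVertices : ∀ {u w m} → Walk u w m → List V
  walkVertices {u} here       = u ∷ []
  walkVertices {u} (step _ p) = u ∷ walkVertices p

  Connected : Set
  Connected = ∀ (u v : V) → ∃ λ m → Walk u v m

  -- bipartite: a 2-colouring in which every non-loop edge joins
  -- vertices of different colours (loops come from reflexivity)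
  Bipartite : Set
  Bipartite = ∃ λ (col : V → Bool) →
    ∀ {u v} → u ~ v → u ≢ v → col u ≢ col v

  record GeodesicPath : Set where
    field
      start end : V
      len       : ℕ
      walk      : Walk start end len
      isPath    : Unique (walkVertices walk)
      shortest  : ∀ m → Walk start end m → len ≤ m

  pathVertices : GeodesicPath → List V
  pathVertices P = walkVertices (GeodesicPath.walk P)

  -- a configuration: positions of the cops still in the game
  -- (a multiset, as a list) and the position of the robber
  Config : Set
  Config = List V × V

  -- the robber moves onto v: if one or more cops are on v,
  -- exactly one of them is removed
  removeOne : V → List V → List V
  removeOne v []       = []
  removeOne v (c ∷ cs) with v ≟ c
  ... | yes _ = cs
  ... | no  _ = c ∷ removeOne v cs

  -- a (history dependent) cop move rule: given the past configurations,
  -- the current cop positions and the robber position, every cop moves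
  -- to an adjacent vertex or stays
  CopMoves : Set
  CopMoves = List Config → (cs : List V) → V → Σ (List V) (Pointwise _~_ cs)

  record CopStrategy : Set where
    field
      placement : List V
      moves     : CopMoves

  -- a robber play: against deterministic cops, a robber strategy
  -- amounts to the sequence of its positions, an infinite walk
  RobberPlay : Set
  RobberPlay = Σ (ℕ → V) λ ρ → ∀ i → ρ i ~ ρ (suc i)

  -- state at the start of a round (cops to move), or robber captured
  data Status : Set where
    caught : Status
    going  : (past : List Config) (cs : List V) (r : V) → Status

  module Play (S : CopStrategy) (R : RobberPlay) where
    open CopStrategy S
    ρ : ℕ → V
    ρ = proj₁ R

    round : ℕ → Status → Status
    round i caught = caught
    round i (going past cs r) with r ∈? proj₁ (moves past cs r)
    ... | yes _ = caught
    ... | no  _ = going ((cs , r) ∷ past)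
                        (removeOne (ρ (suc i)) (proj₁ (moves past cs r)))
                        (ρ (suc i))

    status : ℕ → Status
    status zero    = going [] placement (ρ zero)
    status (suc i) = round i (status i)

  -- Guarding phase: only the k guards g remain, robber at r, robber to
  -- move.  Every time the robber (after his move) is on H, the guards
  -- must capture him with their immediately following move.

  data GStatus : Set where
    gcaught : GStatus
    gfailed : GStatus
    ggoing  : (past : List Config) (cs : List V) (r : V) → GStatus

  module GuardPlay (H : List V) (mv : CopMoves) (σ : ℕ → V) where
    ground : ℕ → GStatus → GStatus
    ground j gcaught = gcaught
    ground j gfailed = gfailed
    ground j (ggoing past cs r)
      with σ (suc j) ∈? proj₁ (mv past (removeOne (σ (suc j)) cs) (σ (suc j)))
    ... | yes _ = gcaught
    ... | no  _ with σ (suc j) ∈? H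
    ...   | yes _ = gfailed
    ...   | no  _ = ggoing ((removeOne (σ (suc j)) cs , σ (suc j)) ∷ past)
                           (proj₁ (mv past (removeOne (σ (suc j)) cs) (σ (suc j))))
                           (σ (suc j))

    gstatus : List V → ℕ → GStatus
    gstatus g zero    = ggoing [] g (σ zero)
    gstatus g (suc j) = ground j (gstatus g j)

  Guards : List V → List V → V → Set
  Guards H g r = Σ CopMoves λ mv →
    ∀ (R : RobberPlay) → proj₁ R zero ≡ r →
    ∀ j → GuardPlay.gstatus H mv (proj₁ R) g j ≢ gfailed

  -- after the cops' move of a round starting in state s, k of the cops
  -- (the others are discarded) sit on H and guard it
  GuardingAfterCopMove : List V → ℕ → CopMoves → Status → Set
  GuardingAfterCopMove H k mv caught = ⊥
  GuardingAfterCopMove H k mv (going past cs r) =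
    r ∉ proj₁ (mv past cs r) ×
    ∃ λ (g : List V) → ∃ λ (o : List V) →
      (g ++ o ↭ proj₁ (mv past cs r)) × length g ≡ k × All (_∈ H) g ×
      Guards H g r

  Guardable : List V → ℕ → ℕ → Set
  Guardable H k t = Σ CopStrategy λ S →
    length (CopStrategy.placement S) ≡ k + t ×
    ∀ (R : RobberPlay) → proj₁ R zero ∉ CopStrategy.placement S →
    ∃ λ N → Play.status S R N ≡ caught
          ⊎ GuardingAfterCopMove H k (CopStrategy.moves S) (Play.status S R N)

-- The cops measure everything by the distance d from the start p₀ of the path
-- P = p₀ … p_L.  A robber at r has the shadow p_t, where t is d(r) when d(r) ≤ L
-- and otherwise whichever of L − 1, L has the parity of d(r) (for L = 0 the
-- path is extended by one edge).  Because adjacent vertices have distances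
-- differing by at most one, the shadow of a robber step is a cop step away
-- from the old shadow; because G is bipartite, the shadow has the colour of
-- the robber, so the robber can never step onto a cop standing on his shadow.
-- Hence a single cop on the shadow captures the robber as soon as he enters P,
-- whose vertices are their own shadows.  To reach the shadow, two cops walk
-- together from p₀ along P; a robber who attacks one of them is captured by
-- the other.

module Submission where

open import Defs
open import Data.Bool using (Bool; not)
open import Data.Bool.Properties using (not-involutive; ¬-not)
open import Data.Empty using (⊥)
open import Data.Fin using (_≟_)
open import Data.Fin.Properties using (any?)
open import Data.List using (List; []; _∷_; length; replicate)
open import Data.List.Membership.Propositional using (_∈_; _∉_)
open import Data.List.Relation.Binary.Permutation.Propositional using (↭-reflexive)
open import Data.List.Relation.Binary.Pointwise using (Pointwise; []; _∷_)
open import Data.List.Relation.Unary.All using ([]; _∷_)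
open import Data.List.Relation.Unary.All.Properties using (All¬⇒¬Any; replicate⁺)
open import Data.List.Relation.Unary.Any using (here; there)
open import Data.Nat using (ℕ; zero; suc; _+_; _∸_; _≤_; _<_; z≤n; s≤s)
open import Data.Nat.GeneralisedArithmetic using (fold)
open import Data.Nat.Properties renaming (_≟_ to _≟ℕ_)
open import Data.Product using (Σ; ∃; ∃₂; _×_; _,_; proj₁; proj₂; map; map₁; map₂)
open import Data.Sum using (_⊎_; inj₁; inj₂)
open import Relation.Binary using (tri<; tri≈; tri>)
open import Relation.Binary.PropositionalEquality
open import Relation.Nullary using (Dec; yes; no; ¬_; contradiction)
open import Relation.Nullary.Decidable using (_×-dec_)

data Near : ℕ → ℕ → Set where
  stay : ∀ {a} → Near a a
  up   : ∀ {a} → Near a (suc a)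
  down : ∀ {a} → Near (suc a) a

Near-sym : ∀ {a b} → Near a b → Near b a
Near-sym stay = stay
Near-sym up   = down
Near-sym down = up

Near-suc : ∀ {a b} → Near a b → Near (suc a) (suc b)
Near-suc stay = stay
Near-suc up   = up
Near-suc down = down

Near⇒≤suc : ∀ {a b} → Near a b → a ≤ suc b
Near⇒≤suc stay = n≤1+n _
Near⇒≤suc up   = ≤-trans (n≤1+n _) (n≤1+n _)
Near⇒≤suc down = ≤-refl

≤suc⇒Near : ∀ {a b} → a ≤ suc b → b ≤ suc a → Near a b
≤suc⇒Near {a} {b} a≤1+b b≤1+a with <-cmp a b
... | tri< a<b _ _ rewrite ≤-antisym b≤1+a a<b = up
... | tri≈ _ refl _ = stay
... | tri> _ _ b<a rewrite ≤-antisym a≤1+b b<a = down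

-- The point of [0, M + 1] of the same parity as d that is nearest to d.
parityClamp : ℕ → ℕ → ℕ
parityClamp zero    zero          = 0
parityClamp zero    (suc zero)    = 1
parityClamp zero    (suc (suc d)) = parityClamp zero d
parityClamp (suc M) zero          = 0
parityClamp (suc M) (suc d)       = suc (parityClamp M d)

parityClamp-≤ : ∀ M d → parityClamp M d ≤ suc M
parityClamp-≤ zero    zero          = z≤n
parityClamp-≤ zero    (suc zero)    = ≤-refl
parityClamp-≤ zero    (suc (suc d)) = parityClamp-≤ zero d
parityClamp-≤ (suc M) zero          = z≤n
parityClamp-≤ (suc M) (suc d)       = s≤s (parityClamp-≤ M d)

parityClamp-id : ∀ M {d} → d ≤ suc M → parityClamp M d ≡ d
parityClamp-id zero    {zero}          _         = refl
parityClamp-id zero    {suc zero}      _         = refl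
parityClamp-id zero    {suc (suc _)}   (s≤s ())
parityClamp-id (suc M) {zero}          _         = refl
parityClamp-id (suc M) {suc d}         (s≤s d≤M) = cong suc (parityClamp-id M d≤M)

fold-not-not : ∀ m b → fold (not b) not m ≡ not (fold b not m)
fold-not-not zero    b = refl
fold-not-not (suc m) b = cong not (fold-not-not m b)

fold-not-parityClamp : ∀ M d b → fold b not (parityClamp M d) ≡ fold b not d
fold-not-parityClamp zero    zero          b = refl
fold-not-parityClamp zero    (suc zero)    b = refl
fold-not-parityClamp zero    (suc (suc d)) b =
  trans (fold-not-parityClamp zero d b) (sym (not-involutive (fold b not d)))
fold-not-parityClamp (suc M) zero          b = refl
fold-not-parityClamp (suc M) (suc d)       b = cong not (fold-not-parityClamp M d b)

parityClamp-near-suc : ∀ M d → Near (parityClamp M d) (parityClamp M (suc d))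
parityClamp-near-suc zero          zero          = up
parityClamp-near-suc zero          (suc zero)    = down
parityClamp-near-suc zero          (suc (suc d)) = parityClamp-near-suc zero d
parityClamp-near-suc (suc zero)    zero          = up
parityClamp-near-suc (suc (suc M)) zero          = up
parityClamp-near-suc (suc M)       (suc d)       = Near-suc (parityClamp-near-suc M d)

parityClamp-near : ∀ M {d e} → Near d e → Near (parityClamp M d) (parityClamp M e)
parityClamp-near M         stay = stay
parityClamp-near M {d}     up   = parityClamp-near-suc M d
parityClamp-near M {e = e} down = Near-sym (parityClamp-near-suc M e)

module _ {P : ℕ → Set} (P? : ∀ m → Dec (P m)) where

  least : ∀ {b} → P b → ∃ λ m → P m × (∀ {j} → j < m → ¬ P j)
  least {b} Pb = below b (b , ≤-refl , Pb)
    where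
    below : ∀ b → (∃ λ n → n ≤ b × P n) → ∃ λ m → P m × (∀ {j} → j < m → ¬ P j)
    below zero    (zero , _ , Pn) = zero , Pn , λ ()
    below (suc b) (n , n≤1+b , Pn) with anyUpTo? P? (suc b)
    ... | yes (j , j<1+b , Pj) = below b (j , ≤-pred j<1+b , Pj)
    ... | no none = n , Pn , λ j<n Pj → none (_ , <-≤-trans j<n n≤1+b , Pj)

module _ (G : Graph) where
  open Graph G
  open import Data.List.Membership.DecPropositional (_≟_ {n}) using (_∈?_)

  private variable
    u v w x c r : V G
    i k m : ℕ
    cs : List (V G)
    past : List (Config G)

  _▷_ : Walk G u v m → v ~ w → Walk G u w (suc m)
  here     ▷ v~w = step v~w here
  step s p ▷ v~w = step s (p ▷ v~w)

  _++ʷ_ : Walk G u v m → Walk G v w k → Walk G u w (m + k)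
  here     ++ʷ q = q
  step s p ++ʷ q = step s (p ++ʷ q)

  walk₀⇒≡ : Walk G u v 0 → v ≡ u
  walk₀⇒≡ here = refl

  walk? : ∀ m u w → Dec (Walk G u w m)
  walk? zero u w with u ≟ w
  ... | yes refl = yes here
  ... | no u≢w   = no λ { here → u≢w refl }
  walk? (suc m) u w with any? (λ v → (u ~? v) ×-dec walk? m v w)
  ... | yes (v , s , p) = yes (step s p)
  ... | no ∄v           = no λ { (step s p) → ∄v (_ , s , p) }

  vertexAt : Walk G u w m → ℕ → V G
  vertexAt {u} _          zero    = u
  vertexAt {u} here       (suc i) = u
  vertexAt     (step _ p) (suc i) = vertexAt p i

  vertexAt-adj : (p : Walk G u w m) → ∀ i → vertexAt p i ~ vertexAt p (suc i)
  vertexAt-adj {u} here       zero    = ~-refl u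
  vertexAt-adj {u} here       (suc i) = ~-refl u
  vertexAt-adj     (step s p) zero    = s
  vertexAt-adj     (step s p) (suc i) = vertexAt-adj p i

  take : (p : Walk G u w m) → i ≤ m → Walk G u (vertexAt p i) i
  take {i = zero}  _          _         = here
  take {i = suc i} (step s p) (s≤s i≤m) = step s (take p i≤m)

  drop : (p : Walk G u w m) → i ≤ m → Walk G (vertexAt p i) w (m ∸ i)
  drop {i = zero}  p          _         = p
  drop {i = suc i} (step s p) (s≤s i≤m) = drop p i≤m

  vertexAt-∈ : (p : Walk G u w m) → ∀ i → vertexAt p i ∈ walkVertices G p
  vertexAt-∈ here       zero    = here refl
  vertexAt-∈ here       (suc i) = here refl
  vertexAt-∈ (step s p) zero    = here refl
  vertexAt-∈ (step s p) (suc i) = there (vertexAt-∈ p i)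

  ∈⇒vertexAt : (p : Walk G u w m) → v ∈ walkVertices G p → ∃ λ i → i ≤ m × v ≡ vertexAt p i
  ∈⇒vertexAt here       (here refl) = 0 , z≤n , refl
  ∈⇒vertexAt (step s p) (here refl) = 0 , z≤n , refl
  ∈⇒vertexAt (step s p) (there v∈) = map suc (map₁ s≤s) (∈⇒vertexAt p v∈)

  stepToward : V G → (cs : List (V G)) → Σ (List (V G)) (Pointwise _~_ cs)
  stepToward x []       = [] , []
  stepToward x (c ∷ cs) with c ~? x
  ... | yes c~x = map (x ∷_) (c~x ∷_) (stepToward x cs)
  ... | no  _   = map (c ∷_) (~-refl c ∷_) (stepToward x cs)

  stepToward-replicate : ∀ k → c ~ x → proj₁ (stepToward x (replicate k c)) ≡ replicate k x
  stepToward-replicate zero    _ = refl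
  stepToward-replicate {c} {x} (suc k) c~x with c ~? x
  ... | yes _    = cong (x ∷_) (stepToward-replicate k c~x)
  ... | no c≁x   = contradiction c~x c≁x

  stepToward-replicate-≁ : ∀ k → ¬ c ~ x → proj₁ (stepToward x (replicate k c)) ≡ replicate k c
  stepToward-replicate-≁ zero    _ = refl
  stepToward-replicate-≁ {c} {x} (suc k) c≁x with c ~? x
  ... | yes c~x = contradiction c~x c≁x
  ... | no _    = cong (c ∷_) (stepToward-replicate-≁ k c≁x)

  stepToward-∈ : x ∈ cs → x ∈ proj₁ (stepToward x cs)
  stepToward-∈ {x} {c ∷ cs} x∈ with c ~? x | x∈
  ... | yes _ | _          = here refl
  ... | no  _ | here x≡c   = here x≡c
  ... | no  _ | there x∈cs = there (stepToward-∈ x∈cs)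

  ∉-replicate : ∀ k → v ≢ x → v ∉ replicate k x
  ∉-replicate k v≢x = All¬⇒¬Any (replicate⁺ k v≢x)

  removeOne-≡ : v ≡ c → removeOne G v (c ∷ cs) ≡ cs
  removeOne-≡ {v} {c} v≡c with v ≟ c
  ... | yes _   = refl
  ... | no v≢c  = contradiction v≡c v≢c

  removeOne-replicate-≢ : ∀ k → v ≢ c → removeOne G v (replicate k c) ≡ replicate k c
  removeOne-replicate-≢ zero    _ = refl
  removeOne-replicate-≢ {v} {c} (suc k) v≢c with v ≟ c
  ... | yes v≡c = contradiction v≡c v≢c
  ... | no _    = cong (c ∷_) (removeOne-replicate-≢ k v≢c)

  CaughtOrGuarding : List (V G) → ℕ → CopStrategy G → RobberPlay G → Set
  CaughtOrGuarding H k S R = ∃ λ N →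
    Play.status G S R N ≡ caught ⊎ GuardingAfterCopMove G H k (CopStrategy.moves S) (Play.status G S R N)

  module _ (S : CopStrategy G) (R : RobberPlay G) where
    open CopStrategy S
    open Play G S R

    status-capture : status i ≡ going past cs r → r ∈ proj₁ (moves past cs r) → status (suc i) ≡ caught
    status-capture {i} {past} {cs} {r} status≡ r∈ rewrite status≡ with r ∈? proj₁ (moves past cs r)
    ... | yes _  = refl
    ... | no r∉  = contradiction r∈ r∉

    status-escape : status i ≡ going past cs r → r ∉ proj₁ (moves past cs r) →
      status (suc i) ≡ going ((cs , r) ∷ past) (removeOne G (ρ (suc i)) (proj₁ (moves past cs r))) (ρ (suc i))
    status-escape {i} {past} {cs} {r} status≡ r∉ rewrite status≡ with r ∈? proj₁ (moves past cs r)
    ... | yes r∈ = contradiction r∈ r∉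
    ... | no _   = refl

    guardingWithOneOfTwo : ∀ {H y} → status i ≡ going past cs r → proj₁ (moves past cs r) ≡ y ∷ y ∷ [] →
      r ≢ y → y ∈ H → Guards G H (y ∷ []) r → GuardingAfterCopMove G H 1 moves (status i)
    guardingWithOneOfTwo {y = y} status≡ moved r≢y y∈H guards rewrite status≡ =
      (λ r∈ → ∉-replicate 2 r≢y (subst (_ ∈_) moved r∈)) ,
      y ∷ [] , y ∷ [] , ↭-reflexive (sym moved) , refl , y∈H ∷ [] , guards

  Covers : (V G → V G) → V G → V G → Set
  Covers T c r = ∀ {r'} → r ~ r' → r' ≢ c × c ~ T r'

  module ShadowGuarding (H : List (V G)) (T : V G → V G)
                        (T-fixes : ∀ {r} → r ∈ H → T r ≡ r)
                        (T-covers : ∀ {r} → T r ≢ r → Covers T (T r) r) where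

    shadowing : CopMoves G
    shadowing _ cs r = stepToward (T r) cs

    covering-move : ∀ {r'} → Covers T c r → r ~ r' →
      proj₁ (shadowing past (removeOne G r' (c ∷ [])) r') ≡ T r' ∷ []
    covering-move {c = c} {r' = r'} covers r~r' = begin
      proj₁ (stepToward (T r') (removeOne G r' (c ∷ [])))
        ≡⟨ cong (λ cs → proj₁ (stepToward (T r') cs)) (removeOne-replicate-≢ 1 (proj₁ (covers r~r'))) ⟩
      proj₁ (stepToward (T r') (c ∷ []))
        ≡⟨ stepToward-replicate 1 (proj₂ (covers r~r')) ⟩
      T r' ∷ []
        ∎
      where open ≡-Reasoning

    module _ (σ : ℕ → V G) (σ-adj : ∀ j → σ j ~ σ (suc j)) where
      open GuardPlay G H shadowing σ

      Safe : ℕ → GStatus G → Set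
      Safe j s = s ≡ gcaught ⊎ ∃₂ λ past c → s ≡ ggoing past (c ∷ []) (σ j) × Covers T c (σ j)

      ground-safe : ∀ j {s} → Safe j s → Safe (suc j) (ground j s)
      ground-safe j (inj₁ refl) = inj₁ refl
      ground-safe j (inj₂ (past , c , refl , covers))
        with σ (suc j) ∈? proj₁ (shadowing past (removeOne G (σ (suc j)) (c ∷ [])) (σ (suc j)))
           | covering-move {past = past} covers (σ-adj j)
      ... | yes _ | _     = inj₁ refl
      ... | no r∉ | moved with σ (suc j) ∈? H
      ...   | yes r∈H = contradiction (subst (_ ∈_) (sym moved) (here (sym (T-fixes r∈H)))) r∉
      ...   | no _    = inj₂ (_ , _ , cong (λ cs → ggoing _ cs _) moved , T-covers T≢r)
        where
        T≢r : T (σ (suc j)) ≢ σ (suc j)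
        T≢r T≡r = r∉ (subst (_ ∈_) (sym moved) (here (sym T≡r)))

      gstatus-safe : Covers T c (σ 0) → ∀ j → Safe j (gstatus (c ∷ []) j)
      gstatus-safe covers zero    = inj₂ ([] , _ , refl , covers)
      gstatus-safe covers (suc j) = ground-safe j (gstatus-safe covers j)

      safe⇒¬failed : ∀ {j s} → Safe j s → s ≢ gfailed
      safe⇒¬failed (inj₁ refl)               ()
      safe⇒¬failed (inj₂ (_ , _ , refl , _)) ()

    covers⇒guards : Covers T c r → Guards G H (c ∷ []) r
    covers⇒guards covers = shadowing , λ (σ , σ-adj) σ₀≡r j →
      safe⇒¬failed σ σ-adj (gstatus-safe σ σ-adj (subst (Covers T _) (sym σ₀≡r) covers) j)

  module Distance (conn : Connected G) (s : V G) where

    private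
      shortestWalk : ∀ v → ∃ λ m → Walk G s v m × (∀ {j} → j < m → ¬ Walk G s v j)
      shortestWalk v = least (λ m → walk? m s v) (proj₂ (conn s v))

    dist : V G → ℕ
    dist v = proj₁ (shortestWalk v)

    dist-walk : ∀ v → Walk G s v (dist v)
    dist-walk v = proj₁ (proj₂ (shortestWalk v))

    dist-minimal : Walk G s v m → dist v ≤ m
    dist-minimal {v} p = ≮⇒≥ λ m<dist → proj₂ (proj₂ (shortestWalk v)) m<dist p

    dist-source : dist s ≡ 0
    dist-source = n≤0⇒n≡0 (dist-minimal here)

    dist-step : u ~ v → dist v ≤ suc (dist u)
    dist-step {u} u~v = dist-minimal (dist-walk u ▷ u~v)

    dist-near : u ~ v → Near (dist u) (dist v)
    dist-near u~v = ≤suc⇒Near (dist-step (~-sym u~v)) (dist-step u~v)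

    dist-along-shortest : (p : Walk G s w m) → (∀ {m'} → Walk G s w m' → m ≤ m') →
                          i ≤ m → dist (vertexAt p i) ≡ i
    dist-along-shortest {m = m} {i} p p-shortest i≤m = ≤-antisym (dist-minimal (take p i≤m)) (≮⇒≥ shortcut)
      where
      shortcut : dist (vertexAt p i) < i → ⊥
      shortcut d<i = <-irrefl refl (begin-strict
        m                               ≤⟨ p-shortest (dist-walk (vertexAt p i) ++ʷ drop p i≤m) ⟩
        dist (vertexAt p i) + (m ∸ i)   <⟨ +-monoˡ-< (m ∸ i) d<i ⟩
        i + (m ∸ i)                     ≡⟨ m+[n∸m]≡n i≤m ⟩
        m                               ∎)
        where open ≤-Reasoning

    neighbour-at-distance-1 : v ≢ s → ∃ λ u → s ~ u × dist u ≡ 1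
    neighbour-at-distance-1 {v} v≢s =
      vertexAt (dist-walk v) 1 , vertexAt-adj (dist-walk v) 0 , dist-along-shortest (dist-walk v) dist-minimal 1≤dist
      where
      1≤dist : 1 ≤ dist v
      1≤dist = n≢0⇒n>0 λ dist≡0 → v≢s (walk₀⇒≡ (subst (Walk G s v) dist≡0 (dist-walk v)))

    module Bipartition (bip : Bipartite G) where

      colour : V G → Bool
      colour = proj₁ bip

      colour-along : (p : Walk G u w m) → colour w ≡ fold (colour u) not m ⊎ ∃ λ m' → m' < m × Walk G u w m'
      colour-along here = inj₁ refl
      colour-along {u} (step {v = v} {m = m} u~v p) with colour-along p | u ≟ v
      ... | inj₂ (m' , m'<m , p') | _       = inj₂ (suc m' , s≤s m'<m , step u~v p')
      ... | inj₁ _                | yes refl = inj₂ (m , ≤-refl , p)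
      ... | inj₁ colour-w          | no u≢v  = inj₁ (begin
        colour _                      ≡⟨ colour-w ⟩
        fold (colour v) not m         ≡⟨ cong (λ b → fold b not m) (¬-not (≢-sym (proj₂ bip u~v u≢v))) ⟩
        fold (not (colour u)) not m   ≡⟨ fold-not-not m (colour u) ⟩
        fold (colour u) not (suc m)   ∎)
        where open ≡-Reasoning

      colour-dist : ∀ v → colour v ≡ fold (colour s) not (dist v)
      colour-dist v with colour-along (dist-walk v)
      ... | inj₁ colour-v           = colour-v
      ... | inj₂ (m , m<dist , p)  = contradiction (dist-minimal p) (<⇒≱ m<dist)

      module Shadow (M : ℕ) (q : ℕ → V G) (q-adj : ∀ i → q i ~ q (suc i))
                    (q-dist : ∀ {i} → i ≤ suc M → dist (q i) ≡ i) where

        shadowIndex : V G → ℕ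
        shadowIndex r = parityClamp M (dist r)

        shadow : V G → V G
        shadow r = q (shadowIndex r)

        q-near : ∀ {i j} → Near i j → q i ~ q j
        q-near {i}     stay = ~-refl (q i)
        q-near {i}     up   = q-adj i
        q-near {j = j} down = ~-sym (q-adj j)

        shadow-adj : ∀ {r r'} → r ~ r' → shadow r ~ shadow r'
        shadow-adj r~r' = q-near (parityClamp-near M (dist-near r~r'))

        shadow-colour : ∀ r → colour (shadow r) ≡ colour r
        shadow-colour r = begin
          colour (shadow r)                            ≡⟨ colour-dist (shadow r) ⟩
          fold (colour s) not (dist (shadow r))        ≡⟨ cong (fold (colour s) not) (q-dist (parityClamp-≤ M (dist r))) ⟩
          fold (colour s) not (parityClamp M (dist r)) ≡⟨ fold-not-parityClamp M (dist r) (colour s) ⟩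
          fold (colour s) not (dist r)                 ≡⟨ colour-dist r ⟨
          colour r                                     ∎
          where open ≡-Reasoning

        shadow-covers : shadow r ≢ r → Covers shadow (shadow r) r
        shadow-covers {r} shadow≢r {r'} r~r' = r'≢shadow , shadow-adj r~r'
          where
          r'≢shadow : r' ≢ shadow r
          r'≢shadow r'≡shadow with r ≟ r'
          ... | yes refl = shadow≢r (sym r'≡shadow)
          ... | no r≢r'  = proj₂ bip r~r' r≢r'
                             (trans (sym (shadow-colour r)) (cong colour (sym r'≡shadow)))

        shadow-fixes : i ≤ suc M → shadow (q i) ≡ q i
        shadow-fixes i≤1+M = cong q (trans (cong (parityClamp M) (q-dist i≤1+M)) (parityClamp-id M i≤1+M))

        module Guarding (H : List (V G)) (H⊆q : ∀ {v} → v ∈ H → ∃ λ i → i ≤ suc M × v ≡ q i) where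

          shadow-fixes-H : v ∈ H → shadow v ≡ v
          shadow-fixes-H v∈H with H⊆q v∈H
          ... | _ , i≤1+M , refl = shadow-fixes i≤1+M

          open ShadowGuarding H shadow shadow-fixes-H shadow-covers public

  module GeodesicGuarding (conn : Connected G) (bip : Bipartite G) (P : GeodesicPath G) where
    open GeodesicPath P
    open Distance conn start
    open Bipartition bip

    H : List (V G)
    H = pathVertices G P

    twoCopsAtStart : List (V G)
    twoCopsAtStart = start ∷ start ∷ []

    pounce : CopStrategy G
    pounce = record { placement = twoCopsAtStart ; moves = λ _ cs r → stepToward r cs }

    start-guards : len ≡ 0 → r ≢ start → ¬ start ~ r → Guards G H (start ∷ []) r
    start-guards {r} len≡0 r≢start start≁r = covers⇒guards covers
      where
      neighbour : ∃ λ u → start ~ u × dist u ≡ 1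
      neighbour = neighbour-at-distance-1 r≢start

      q : ℕ → V G
      q zero    = start
      q (suc _) = proj₁ neighbour

      start~q : ∀ i → start ~ q i
      start~q zero    = ~-refl start
      start~q (suc _) = proj₁ (proj₂ neighbour)

      q-adj : ∀ i → q i ~ q (suc i)
      q-adj zero    = proj₁ (proj₂ neighbour)
      q-adj (suc _) = ~-refl (proj₁ neighbour)

      q-dist : ∀ {i} → i ≤ 1 → dist (q i) ≡ i
      q-dist {zero}        _        = dist-source
      q-dist {suc zero}    _        = proj₂ (proj₂ neighbour)
      q-dist {suc (suc _)} (s≤s ())

      H⊆q : v ∈ H → ∃ λ i → i ≤ 1 × v ≡ q i
      H⊆q v∈H with ∈⇒vertexAt walk v∈H
      ... | i , i≤len , refl with subst (i ≤_) len≡0 i≤len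
      ...   | z≤n = 0 , z≤n , refl

      open Shadow 0 q q-adj q-dist
      open Guarding H H⊆q

      covers : Covers shadow start r
      covers {r'} r~r' = (λ r'≡start → start≁r (~-sym (subst (r ~_) r'≡start r~r'))) , start~q (shadowIndex r')

    pounce-wins : len ≡ 0 → ∀ R → proj₁ R zero ∉ twoCopsAtStart → CaughtOrGuarding H 1 pounce R
    pounce-wins len≡0 R ρ₀∉ with start ~? proj₁ R zero
    ... | yes start~ρ₀ = 1 , inj₁ (status-capture pounce R {i = 0} refl
      (subst (_ ∈_) (sym (stepToward-replicate 2 start~ρ₀)) (here refl)))
    ... | no start≁ρ₀ = 0 , inj₂ (guardingWithOneOfTwo pounce R {i = 0} refl
      (stepToward-replicate-≁ 2 start≁ρ₀) ρ₀≢start (vertexAt-∈ walk 0)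
      (start-guards len≡0 ρ₀≢start start≁ρ₀))
      where
      ρ₀≢start : proj₁ R zero ≢ start
      ρ₀≢start ρ₀≡start = ρ₀∉ (here ρ₀≡start)

    module Approach (M : ℕ) (len≡1+M : len ≡ suc M) where

      p : ℕ → V G
      p = vertexAt walk

      p-dist : ∀ {i} → i ≤ suc M → dist (p i) ≡ i
      p-dist {i} i≤1+M = dist-along-shortest walk (shortest _) (subst (i ≤_) (sym len≡1+M) i≤1+M)

      H⊆p : v ∈ H → ∃ λ i → i ≤ suc M × v ≡ p i
      H⊆p v∈H = map₂ (map₁ (subst (_ ≤_) len≡1+M)) (∈⇒vertexAt walk v∈H)

      open Shadow M p (vertexAt-adj walk) p-dist
      open Guarding H H⊆p

      advance : ℕ → V G → V G
      advance k r with k <? shadowIndex r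
      ... | yes _ = p (suc k)
      ... | no  _ = p k

      advance-adj : ∀ k r → p k ~ advance k r
      advance-adj k r with k <? shadowIndex r
      ... | yes _ = vertexAt-adj walk k
      ... | no  _ = ~-refl (p k)

      advance-∈ : ∀ k r → advance k r ∈ H
      advance-∈ k r with k <? shadowIndex r
      ... | yes _ = vertexAt-∈ walk (suc k)
      ... | no  _ = vertexAt-∈ walk k

      advance-cases : k ≤ shadowIndex r →
        advance k r ≡ shadow r ⊎ (advance k r ≡ p (suc k) × suc k < shadowIndex r)
      advance-cases {k} {r} k≤t with k <? shadowIndex r
      ... | no  k≮t = inj₁ (cong p (≤-antisym k≤t (≮⇒≥ k≮t)))
      ... | yes k<t with suc k ≟ℕ shadowIndex r
      ...   | yes 1+k≡t = inj₁ (cong p 1+k≡t)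
      ...   | no  1+k≢t = inj₂ (refl , ≤∧≢⇒< k<t 1+k≢t)

      chase : List (Config G) → List (V G) → V G → V G
      chase past cs r with r ∈? cs
      ... | yes _ = r
      ... | no  _ = advance (length past) r

      chase-∉ : r ∉ cs → chase past cs r ≡ advance (length past) r
      chase-∉ {r} {cs} r∉ with r ∈? cs
      ... | yes r∈ = contradiction r∈ r∉
      ... | no  _  = refl

      approach : CopStrategy G
      approach = record { placement = twoCopsAtStart ; moves = λ past cs r → stepToward (chase past cs r) cs }

      chase-captures : r ∈ cs → r ∈ proj₁ (CopStrategy.moves approach past cs r)
      chase-captures {r} {cs} r∈ with r ∈? cs
      ... | yes _  = stepToward-∈ r∈
      ... | no r∉  = contradiction r∈ r∉

      module _ (R : RobberPlay G) where
        open Play G approach R using (ρ; status)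

        record Approaching (k : ℕ) : Set where
          field
            history        : List (Config G)
            status≡        : status k ≡ going history (p k ∷ p k ∷ []) (ρ k)
            length-history : length history ≡ k
            behind         : k ≤ shadowIndex (ρ k)
            evading        : ρ k ≢ p k

        approaching-start : ρ 0 ∉ twoCopsAtStart → Approaching 0
        approaching-start ρ₀∉ = record
          { history        = []
          ; status≡        = refl
          ; length-history = refl
          ; behind         = z≤n
          ; evading        = λ ρ₀≡start → ρ₀∉ (here ρ₀≡start)
          }

        module _ {k} (a : Approaching k) where
          open Approaching a

          cops-advance : proj₁ (CopStrategy.moves approach history (p k ∷ p k ∷ []) (ρ k))
                         ≡ advance k (ρ k) ∷ advance k (ρ k) ∷ []
          cops-advance = begin
            proj₁ (stepToward (chase history cops (ρ k)) cops)
              ≡⟨ cong (λ x → proj₁ (stepToward x cops)) (chase-∉ (∉-replicate 2 evading)) ⟩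
            proj₁ (stepToward (advance (length history) (ρ k)) cops)
              ≡⟨ cong (λ j → proj₁ (stepToward (advance j (ρ k)) cops)) length-history ⟩
            proj₁ (stepToward (advance k (ρ k)) cops)
              ≡⟨ stepToward-replicate 2 (advance-adj k (ρ k)) ⟩
            advance k (ρ k) ∷ advance k (ρ k) ∷ []
              ∎
            where
            open ≡-Reasoning
            cops : List (V G)
            cops = p k ∷ p k ∷ []

          advancing : ρ k ≢ p (suc k) → advance k (ρ k) ≡ p (suc k) → suc k < shadowIndex (ρ k) →
                      CaughtOrGuarding H 1 approach R ⊎ Approaching (suc k)
          advancing ρ≢p advance≡p 1+k<t = robberMoves (ρ (suc k) ≟ p (suc k))
            where
            history′ : List (Config G)
            history′ = (p k ∷ p k ∷ [] , ρ k) ∷ history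

            moved : proj₁ (CopStrategy.moves approach history (p k ∷ p k ∷ []) (ρ k))
                    ≡ p (suc k) ∷ p (suc k) ∷ []
            moved = trans cops-advance (cong (λ x → x ∷ x ∷ []) advance≡p)

            escaped : status (suc k)
                      ≡ going history′ (removeOne G (ρ (suc k)) (p (suc k) ∷ p (suc k) ∷ [])) (ρ (suc k))
            escaped = trans (status-escape approach R {i = k} status≡
                               λ ρ∈ → ∉-replicate 2 ρ≢p (subst (_ ∈_) moved ρ∈))
                            (cong (λ cs → going history′ (removeOne G (ρ (suc k)) cs) (ρ (suc k))) moved)

            robberMoves : Dec (ρ (suc k) ≡ p (suc k)) → CaughtOrGuarding H 1 approach R ⊎ Approaching (suc k)
            robberMoves (yes attack) = inj₁ (suc (suc k) , inj₁ (status-capture approach R {i = suc k}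
              (trans escaped (cong (λ cs → going history′ cs (ρ (suc k))) (removeOne-≡ attack)))
              (chase-captures (here attack))))
            robberMoves (no ρ′≢p) = inj₂ record
              { history        = history′
              ; status≡        = trans escaped
                                   (cong (λ cs → going history′ cs (ρ (suc k))) (removeOne-replicate-≢ 2 ρ′≢p))
              ; length-history = cong suc length-history
              ; behind         = ≤-pred (<-≤-trans 1+k<t (Near⇒≤suc (parityClamp-near M (dist-near (proj₂ R k)))))
              ; evading        = ρ′≢p
              }

          approaching-step : CaughtOrGuarding H 1 approach R ⊎ Approaching (suc k)
          approaching-step with ρ k ≟ advance k (ρ k) | advance-cases behind
          ... | yes ρ≡next | _ = inj₁ (suc k , inj₁ (status-capture approach R {i = k} status≡
            (subst (ρ k ∈_) (sym cops-advance) (here ρ≡next))))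
          ... | no ρ≢next | inj₁ next≡shadow = inj₁ (k , inj₂ (guardingWithOneOfTwo approach R {i = k} status≡
            cops-advance ρ≢next (advance-∈ k (ρ k)) (covers⇒guards covers)))
            where
            covers : Covers shadow (advance k (ρ k)) (ρ k)
            covers = subst (λ c → Covers shadow c (ρ k)) (sym next≡shadow)
                       (shadow-covers λ shadow≡ρ → ρ≢next (sym (trans next≡shadow shadow≡ρ)))
          ... | no ρ≢next | inj₂ (next≡p , 1+k<t) =
            advancing (λ ρ≡p → ρ≢next (trans ρ≡p (sym next≡p))) next≡p 1+k<t

        approach-progress : ρ 0 ∉ twoCopsAtStart → ∀ k → CaughtOrGuarding H 1 approach R ⊎ Approaching k
        approach-progress ρ₀∉ zero = inj₂ (approaching-start ρ₀∉)
        approach-progress ρ₀∉ (suc k) with approach-progress ρ₀∉ k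
        ... | inj₁ done = inj₁ done
        ... | inj₂ a    = approaching-step a

        approach-wins : ρ 0 ∉ twoCopsAtStart → CaughtOrGuarding H 1 approach R
        approach-wins ρ₀∉ with approach-progress ρ₀∉ (suc (suc M))
        ... | inj₁ done = done
        ... | inj₂ a    = contradiction (≤-trans (Approaching.behind a) (parityClamp-≤ M _)) (1+n≰n)

mainTheorem6 : (G : Graph) → Connected G → Bipartite G →
    (P : GeodesicPath G) → Guardable G (pathVertices G P) 1 1
mainTheorem6 G conn bip P = guardable (GeodesicPath.len P) refl
  where
  open GeodesicGuarding G conn bip P

  guardable : ∀ L → GeodesicPath.len P ≡ L → Guardable G (pathVertices G P) 1 1
  guardable zero    len≡0   = pounce , refl , pounce-wins len≡0
  guardable (suc M) len≡1+M = approach , refl , approach-wins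
    where open Approach M len≡1+M
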